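{- Let $(G_1,G_2,S)$ be a constrained alignment instance with $m_2=1$, and assume $G_1$ is acyclic. Let $k\geq 4$ and let $x_1-x_2-\cdots-x_k$ be an induced path $P_k$ in the conflict graph $\mathcal{C}$. Then the $c_4$s $x_1$ and $x_k$ share neither a vertex nor an edge (as subgraphs of $G_1\cup G_2\cup S$).
   Context: Let $G_1=(V_1,E_1)$ and $G_2=(V_2,E_2)$ be finite simple undirected graphs with $V_1\cap V_2=\emptyset$, and let $S$ be a bipartite graph with parts $V_1,V_2$ in which every vertex of $V_1$ has degree at most $m_1$ and every vertex of $V_2$ has degree at most $m_2$ ($m_1,m_2$ positive integers); edges of $S$ are called similarity edges. A $c_4$ is a 4-cycle $a-b-c-d-a$ in the union graph $G_1\cup G_2\cup S$ with $a,b\in V_1$, $c,d\in V_2$, $ab\in E_1$, $cd\in E_2$ and $ad,bc\in E(S)$; it is written $abcd$ and regarded as a subgraph. Two distinct $c_4$s conflict if their similarity edges cannot all belong to a common matching of $S$, i.e. some similarity edge of one and some different similarity edge of the other share an endpoint. The conflict graph $\mathcal{C}$ has one vertex for each $c_4$ and an edge between every pair of conflicting $c_4$s; vertices of $\mathcal{C}$ are identified with their $c_4$s. -}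

module Defs where

open import Data.Nat using (ℕ; zero; suc; _+_; _≤_)
open import Data.Fin using (Fin; toℕ; inject₁; fromℕ) renaming (zero to fzero; suc to fsuc)
open import Data.Bool using (Bool; true; false; if_then_else_)
open import Data.List using (List; map; allFin)
open import Data.Nat.ListAction using (sum)
open import Data.Product using (Σ; ∃; _×_; _,_)
open import Data.Sum using (_⊎_)
open import Relation.Binary.PropositionalEquality using (_≡_)
open import Relation.Nullary using (¬_)

record SimpleGraph (n : ℕ) : Set where
  field
    adj   : Fin n → Fin n → Bool
    sym   : ∀ u v → adj u v ≡ adj v u
    irrefl : ∀ v → adj v v ≡ false
open SimpleGraph public

Edge : ∀ {n} → SimpleGraph n → Fin n → Fin n → Set
Edge G u v = adj G u v ≡ true

Bip : ℕ → ℕ → Set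
Bip n1 n2 = Fin n1 → Fin n2 → Bool

indicator : Bool → ℕ
indicator true  = 1
indicator false = 0

deg₁ : ∀ {n1 n2} → Bip n1 n2 → Fin n1 → ℕ
deg₁ {n1} {n2} S u = sum (map (λ w → indicator (S u w)) (allFin n2))

deg₂ : ∀ {n1 n2} → Bip n1 n2 → Fin n2 → ℕ
deg₂ {n1} {n2} S w = sum (map (λ u → indicator (S u w)) (allFin n1))

record Instance (n1 n2 m1 m2 : ℕ) : Set where
  field
    G₁ : SimpleGraph n1
    G₂ : SimpleGraph n2
    S  : Bip n1 n2
    m1-pos : 1 ≤ m1
    m2-pos : 1 ≤ m2
    deg₁-bound : ∀ u → deg₁ S u ≤ m1
    deg₂-bound : ∀ w → deg₂ S w ≤ m2
open Instance public

record Cycle {n : ℕ} (G : SimpleGraph n) : Set where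
  field
    len   : ℕ
    vtx   : Fin (3 + len) → Fin n
    inj   : ∀ i j → vtx i ≡ vtx j → i ≡ j
    step  : ∀ (i : Fin (2 + len)) → Edge G (vtx (inject₁ i)) (vtx (fsuc i))
    close : Edge G (vtx (fromℕ (2 + len))) (vtx fzero)

Acyclic : ∀ {n} → SimpleGraph n → Set
Acyclic G = ¬ Cycle G

module _ {n1 n2 m1 m2 : ℕ} (I : Instance n1 n2 m1 m2) where

  SimEdge : Fin n1 → Fin n2 → Set
  SimEdge u w = S I u w ≡ true

  record C4 : Set where
    constructor c4
    field
      a b : Fin n1
      c d : Fin n2
      ab : Edge (G₁ I) a b
      cd : Edge (G₂ I) c d
      ad : SimEdge a d
      bc : SimEdge b c

  open C4

  InV₁ : C4 → Fin n1 → Set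
  InV₁ x u = u ≡ a x ⊎ u ≡ b x

  InV₂ : C4 → Fin n2 → Set
  InV₂ x w = w ≡ c x ⊎ w ≡ d x

  HasE₁ : C4 → Fin n1 → Fin n1 → Set
  HasE₁ x u v = (u ≡ a x × v ≡ b x) ⊎ (u ≡ b x × v ≡ a x)

  HasE₂ : C4 → Fin n2 → Fin n2 → Set
  HasE₂ x w z = (w ≡ c x × z ≡ d x) ⊎ (w ≡ d x × z ≡ c x)

  HasS : C4 → Fin n1 → Fin n2 → Set
  HasS x u w = (u ≡ a x × w ≡ d x) ⊎ (u ≡ b x × w ≡ c x)

  -- Two c4s are the same subgraph (abcd and badc describe the same c4).
  SameC4 : C4 → C4 → Set
  SameC4 x y = (a x ≡ a y × b x ≡ b y × c x ≡ c y × d x ≡ d y)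
             ⊎ (a x ≡ b y × b x ≡ a y × c x ≡ d y × d x ≡ c y)

  Conflict : C4 → C4 → Set
  Conflict x y =
    ¬ SameC4 x y ×
    Σ (Fin n1) λ u → Σ (Fin n2) λ w → Σ (Fin n1) λ u' → Σ (Fin n2) λ w' →
      HasS x u w × HasS y u' w' × ¬ (u ≡ u' × w ≡ w') × (u ≡ u' ⊎ w ≡ w')

  record InducedPath (k : ℕ) (x : Fin k → C4) : Set where
    field
      distinct : ∀ i j → SameC4 (x i) (x j) → i ≡ j
      adjacent : ∀ i j → toℕ j ≡ suc (toℕ i) → Conflict (x i) (x j)
      induced  : ∀ i j → Conflict (x i) (x j) →
                 toℕ j ≡ suc (toℕ i) ⊎ toℕ i ≡ suc (toℕ j)

  ShareVertex : C4 → C4 → Set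
  ShareVertex x y = (∃ λ u → InV₁ x u × InV₁ y u) ⊎ (∃ λ w → InV₂ x w × InV₂ y w)

  ShareEdge : C4 → C4 → Set
  ShareEdge x y =
      (∃ λ u → ∃ λ v → HasE₁ x u v × HasE₁ y u v)
    ⊎ (∃ λ w → ∃ λ z → HasE₂ x w z × HasE₂ y w z)
    ⊎ (∃ λ u → ∃ λ w → HasS x u w × HasS y u w)

-- Since m₂ = 1, two c4s conflict exactly when they contain a common vertex u ∈ V₁ whose
-- similarity edges in the two c4s differ.  If the endpoints x₁, x_k shared a vertex u, they
-- would (not being in conflict) use the same similarity edge (u, w), and every c4 of the path
-- that contains u uses it as well: otherwise it would conflict with both endpoints, which have
-- no common neighbour on an induced path with k ≥ 4 vertices.  Hence a conflict along the path
-- never happens at u, so starting from the E₁-edge uv of x₁, every V₁-vertex met along the path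
-- is u or lies in the component of v in G₁ − u.  The E₁-edge uv' of x_k then closes a cycle in
-- G₁ unless v' = v, and v' = v forces x_k = x₁.  A shared V₂-vertex or edge yields a shared
-- V₁-vertex, the unique similarity neighbour of that V₂-vertex.
module Submission where

open import Defs hiding (sym)
open import Data.Nat using (ℕ; suc; _+_; _≤_)
open import Data.Nat.Properties
  using (≤-trans; m≤m+n; m≤n+m; +-monoʳ-≤; +-monoˡ-≤; +-comm; ≤-reflexive; n≮n)
open import Data.Nat.ListAction using (sum)
open import Data.Fin using (Fin; inject₁; fromℕ; _≟_) renaming (zero to fzero; suc to fsuc)
open import Data.Fin.Properties using (toℕ-inject₁)
open import Data.Fin.Induction using (<-weakInduction)
open import Data.Bool using (true)
open import Data.List using (_∷_; map; allFin)
open import Data.List.Relation.Unary.Any using (here; there)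
open import Data.List.Membership.Propositional using (_∈_)
open import Data.List.Membership.Propositional.Properties using (∈-allFin)
open import Data.Product using (Σ; ∃; _×_; _,_)
open import Data.Sum using (_⊎_; inj₁; inj₂)
open import Data.Empty using (⊥-elim)
open import Relation.Binary.Construct.Closure.ReflexiveTransitive using (Star; ε; _◅_; _◅◅_)
open import Relation.Nullary using (¬_; Dec; yes; no)
open import Relation.Binary.PropositionalEquality
  using (_≡_; _≢_; refl; sym; trans; cong; subst; subst₂)

module _ {A : Set} (f : A → ℕ) where

  sum-map-≥-member : ∀ {u} xs → u ∈ xs → f u ≤ sum (map f xs)
  sum-map-≥-member (x ∷ xs) (here refl) = m≤m+n (f x) _
  sum-map-≥-member (x ∷ xs) (there u∈xs) = ≤-trans (sum-map-≥-member xs u∈xs) (m≤n+m _ (f x))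

  sum-map-≥-pair : ∀ {u u'} xs → u ∈ xs → u' ∈ xs → u ≢ u' → f u + f u' ≤ sum (map f xs)
  sum-map-≥-pair (x ∷ xs) (here refl) (here refl) u≢u' = ⊥-elim (u≢u' refl)
  sum-map-≥-pair (x ∷ xs) (here refl) (there u'∈xs) _ = +-monoʳ-≤ (f x) (sum-map-≥-member xs u'∈xs)
  sum-map-≥-pair (x ∷ xs) (there u∈xs) (here refl) _ =
    ≤-trans (+-monoˡ-≤ (f x) (sum-map-≥-member xs u∈xs)) (≤-reflexive (+-comm _ (f x)))
  sum-map-≥-pair (x ∷ xs) (there u∈xs) (there u'∈xs) u≢u' =
    ≤-trans (sum-map-≥-pair xs u∈xs u'∈xs u≢u') (m≤n+m _ (f x))

deg₂≤1⇒left-unique : ∀ {n1 n2} (S : Bip n1 n2) {u u' w} → deg₂ S w ≤ 1 →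
                     S u w ≡ true → S u' w ≡ true → u ≡ u'
deg₂≤1⇒left-unique {n1} S {u} {u'} {w} deg≤1 uw u'w with u ≟ u'
... | yes u≡u' = u≡u'
... | no u≢u' = ⊥-elim (n≮n 1 (subst₂ (λ s s' → indicator s + indicator s' ≤ 1) uw u'w both≤1))
  where
  both≤1 : indicator (S u w) + indicator (S u' w) ≤ 1
  both≤1 = ≤-trans
    (sum-map-≥-pair (λ t → indicator (S t w)) (allFin n1) (∈-allFin u) (∈-allFin u') u≢u') deg≤1

module _ {n : ℕ} (G : SimpleGraph n) where

  Edge⇒≢ : ∀ {s t} → Edge G s t → s ≢ t
  Edge⇒≢ {s} st refl with () ← trans (sym st) (irrefl G s)

  Edge-sym : ∀ {s t} → Edge G s t → Edge G t s
  Edge-sym {s} {t} st = trans (SimpleGraph.sym G t s) st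

  EdgeAvoiding : Fin n → Fin n → Fin n → Set
  EdgeAvoiding u s t = Edge G s t × t ≢ u

  module SimplePaths {u v : Fin n} (uv : Edge G u v) where

    v≢u : v ≢ u
    v≢u v≡u = Edge⇒≢ uv (sym v≡u)

    data SimplePath : ℕ → Fin n → Set
    _∈ₚ_ : ∀ {L s} → Fin n → SimplePath L s → Set

    data SimplePath where
      [] : SimplePath 0 v
      cons : ∀ {L s} t (p : SimplePath L s) → Edge G t s → ¬ t ∈ₚ p → t ≢ u → SimplePath (suc L) t

    t ∈ₚ [] = t ≡ v
    t ∈ₚ cons t' p _ _ _ = t ≡ t' ⊎ t ∈ₚ p

    _∈ₚ?_ : ∀ {L s} t (p : SimplePath L s) → Dec (t ∈ₚ p)
    t ∈ₚ? [] = t ≟ v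
    t ∈ₚ? cons t' p _ _ _ with t ≟ t' | t ∈ₚ? p
    ... | yes t≡t' | _ = yes (inj₁ t≡t')
    ... | no _ | yes t∈p = yes (inj₂ t∈p)
    ... | no t≢t' | no t∉p = no λ { (inj₁ t≡t') → t≢t' t≡t' ; (inj₂ t∈p) → t∉p t∈p }

    drop-until : ∀ {L s t} (p : SimplePath L s) → t ∈ₚ p → ∃ λ L' → SimplePath L' t
    drop-until [] refl = 0 , []
    drop-until p@(cons _ _ _ _ _) (inj₁ refl) = _ , p
    drop-until (cons _ p _ _ _) (inj₂ t∈p) = drop-until p t∈p

    -- If t already lies on the path, the loop through t is cut off.
    extend : ∀ {L s t} → SimplePath L s → EdgeAvoiding u s t → ∃ λ L' → SimplePath L' t
    extend {t = t} p (st , t≢u) with t ∈ₚ? p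
    ... | yes t∈p = drop-until p t∈p
    ... | no t∉p = _ , cons t p (Edge-sym st) t∉p t≢u

    walk⇒simplePath : ∀ {L s t} → SimplePath L s → Star (EdgeAvoiding u) s t → ∃ λ L' → SimplePath L' t
    walk⇒simplePath p ε = _ , p
    walk⇒simplePath p (st ◅ walk) = let _ , p' = extend p st in walk⇒simplePath p' walk

    vertex : ∀ {L s} → SimplePath L s → Fin (suc L) → Fin n
    vertex [] fzero = v
    vertex (cons t _ _ _ _) fzero = t
    vertex (cons _ p _ _ _) (fsuc i) = vertex p i

    vertex-∈ₚ : ∀ {L s} (p : SimplePath L s) i → vertex p i ∈ₚ p
    vertex-∈ₚ [] fzero = refl
    vertex-∈ₚ (cons _ _ _ _ _) fzero = inj₁ refl
    vertex-∈ₚ (cons _ p _ _ _) (fsuc i) = inj₂ (vertex-∈ₚ p i)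

    vertex-≢u : ∀ {L s} (p : SimplePath L s) i → vertex p i ≢ u
    vertex-≢u [] fzero = v≢u
    vertex-≢u (cons _ _ _ _ t≢u) fzero = t≢u
    vertex-≢u (cons _ p _ _ _) (fsuc i) = vertex-≢u p i

    vertex-injective : ∀ {L s} (p : SimplePath L s) i j → vertex p i ≡ vertex p j → i ≡ j
    vertex-injective [] fzero fzero _ = refl
    vertex-injective (cons _ _ _ _ _) fzero fzero _ = refl
    vertex-injective (cons _ p _ t∉p _) fzero (fsuc j) t≡ =
      ⊥-elim (t∉p (subst (_∈ₚ p) (sym t≡) (vertex-∈ₚ p j)))
    vertex-injective (cons _ p _ t∉p _) (fsuc i) fzero ≡t =
      ⊥-elim (t∉p (subst (_∈ₚ p) ≡t (vertex-∈ₚ p i)))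
    vertex-injective (cons _ p _ _ _) (fsuc i) (fsuc j) eq = cong fsuc (vertex-injective p i j eq)

    vertex-first : ∀ {L s} (p : SimplePath L s) → vertex p fzero ≡ s
    vertex-first [] = refl
    vertex-first (cons _ _ _ _ _) = refl

    vertex-last : ∀ {L s} (p : SimplePath L s) → vertex p (fromℕ L) ≡ v
    vertex-last [] = refl
    vertex-last (cons _ p _ _ _) = vertex-last p

    vertex-step : ∀ {L s} (p : SimplePath L s) i → Edge G (vertex p (inject₁ i)) (vertex p (fsuc i))
    vertex-step (cons t p ts _ _) fzero = subst (Edge G t) (sym (vertex-first p)) ts
    vertex-step (cons _ p _ _ _) (fsuc i) = vertex-step p i

    simplePath-length0 : ∀ {t} → SimplePath 0 t → t ≡ v
    simplePath-length0 [] = refl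

    close-cycle : ∀ {len t} → SimplePath (suc len) t → Edge G u t → Cycle G
    close-cycle {len} p ut = record
      { len = len ; vtx = vtx ; inj = inj ; step = step
      ; close = subst (λ s → Edge G s u) (sym (vertex-last p)) (Edge-sym uv) }
      where
      vtx : Fin (3 + len) → Fin n
      vtx fzero = u
      vtx (fsuc i) = vertex p i

      inj : ∀ i j → vtx i ≡ vtx j → i ≡ j
      inj fzero fzero _ = refl
      inj fzero (fsuc j) u≡ = ⊥-elim (vertex-≢u p j (sym u≡))
      inj (fsuc i) fzero ≡u = ⊥-elim (vertex-≢u p i ≡u)
      inj (fsuc i) (fsuc j) eq = cong fsuc (vertex-injective p i j eq)

      step : ∀ (i : Fin (2 + len)) → Edge G (vtx (inject₁ i)) (vtx (fsuc i))
      step fzero = subst (Edge G u) (sym (vertex-first p)) ut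
      step (fsuc i) = vertex-step p i

    acyclic⇒neighbours-disconnected : Acyclic G → ∀ {t} → Edge G u t → Star (EdgeAvoiding u) v t → t ≡ v
    acyclic⇒neighbours-disconnected acyclic ut walk with walk⇒simplePath [] walk
    ... | 0 , p = simplePath-length0 p
    ... | suc _ , p = ⊥-elim (acyclic (close-cycle p ut))

module _ {n1 n2 m1 m2 : ℕ} {I : Instance n1 n2 m1 m2} where
  open C4

  HasS⇒SimEdge : ∀ y {u q} → HasS I y u q → SimEdge I u q
  HasS⇒SimEdge y (inj₁ (refl , refl)) = ad y
  HasS⇒SimEdge y (inj₂ (refl , refl)) = bc y

  HasS⇒InV₁ : ∀ y {u q} → HasS I y u q → InV₁ I y u
  HasS⇒InV₁ _ (inj₁ (u≡a , _)) = inj₁ u≡a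
  HasS⇒InV₁ _ (inj₂ (u≡b , _)) = inj₂ u≡b

  InV₁⇒HasS : ∀ y {u} → InV₁ I y u → ∃ (HasS I y u)
  InV₁⇒HasS y (inj₁ u≡a) = d y , inj₁ (u≡a , refl)
  InV₁⇒HasS y (inj₂ u≡b) = c y , inj₂ (u≡b , refl)

  InV₂⇒HasS : ∀ y {w} → InV₂ I y w → ∃ λ t → HasS I y t w
  InV₂⇒HasS y (inj₁ w≡c) = b y , inj₂ (refl , w≡c)
  InV₂⇒HasS y (inj₂ w≡d) = a y , inj₁ (refl , w≡d)

  InV₁⇒mate : ∀ y {u} → InV₁ I y u →
              ∃ λ v → Edge (G₁ I) u v × InV₁ I y v × (∀ {s} → InV₁ I y s → s ≡ u ⊎ s ≡ v)
  InV₁⇒mate y (inj₁ refl) = b y , ab y , inj₂ refl , λ s∈y → s∈y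
  InV₁⇒mate y (inj₂ refl) = a y , Edge-sym (G₁ I) (ab y) , inj₁ refl ,
    λ { (inj₁ s≡a) → inj₂ s≡a ; (inj₂ s≡b) → inj₁ s≡b }

  HasS-functional : ∀ y {u q q'} → HasS I y u q → HasS I y u q' → q ≡ q'
  HasS-functional y (inj₁ (refl , refl)) (inj₁ (_ , refl)) = refl
  HasS-functional y (inj₁ (refl , refl)) (inj₂ (a≡b , _)) = ⊥-elim (Edge⇒≢ (G₁ I) (ab y) a≡b)
  HasS-functional y (inj₂ (refl , refl)) (inj₁ (b≡a , _)) = ⊥-elim (Edge⇒≢ (G₁ I) (ab y) (sym b≡a))
  HasS-functional y (inj₂ (refl , refl)) (inj₂ (_ , refl)) = refl

  SameC4-HasS : ∀ y z {u q} → SameC4 I y z → HasS I y u q → HasS I z u q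
  SameC4-HasS _ _ (inj₁ (a≡ , _ , _ , d≡)) (inj₁ (u≡ , q≡)) = inj₁ (trans u≡ a≡ , trans q≡ d≡)
  SameC4-HasS _ _ (inj₁ (_ , b≡ , c≡ , _)) (inj₂ (u≡ , q≡)) = inj₂ (trans u≡ b≡ , trans q≡ c≡)
  SameC4-HasS _ _ (inj₂ (a≡ , _ , _ , d≡)) (inj₁ (u≡ , q≡)) = inj₂ (trans u≡ a≡ , trans q≡ d≡)
  SameC4-HasS _ _ (inj₂ (_ , b≡ , c≡ , _)) (inj₂ (u≡ , q≡)) = inj₁ (trans u≡ b≡ , trans q≡ c≡)

  SimEdgesAre : C4 I → Fin n1 → Fin n2 → Fin n1 → Fin n2 → Set
  SimEdgesAre y u q v p = (a y ≡ u × d y ≡ q × b y ≡ v × c y ≡ p)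
                        ⊎ (b y ≡ u × c y ≡ q × a y ≡ v × d y ≡ p)

  HasS-pair⇒SimEdgesAre : ∀ y {u q v p} → HasS I y u q → HasS I y v p → u ≢ v → SimEdgesAre y u q v p
  HasS-pair⇒SimEdgesAre y (inj₁ (refl , refl)) (inj₁ (refl , refl)) u≢v = ⊥-elim (u≢v refl)
  HasS-pair⇒SimEdgesAre y (inj₁ (refl , refl)) (inj₂ (refl , refl)) _ = inj₁ (refl , refl , refl , refl)
  HasS-pair⇒SimEdgesAre y (inj₂ (refl , refl)) (inj₁ (refl , refl)) _ = inj₂ (refl , refl , refl , refl)
  HasS-pair⇒SimEdgesAre y (inj₂ (refl , refl)) (inj₂ (refl , refl)) u≢v = ⊥-elim (u≢v refl)

  SimEdgesAre⇒SameC4 : ∀ y z {u q v p} → SimEdgesAre y u q v p → SimEdgesAre z u q v p → SameC4 I y z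
  SimEdgesAre⇒SameC4 y z (inj₁ (a₁ , d₁ , b₁ , c₁)) (inj₁ (a₂ , d₂ , b₂ , c₂)) =
    inj₁ (trans a₁ (sym a₂) , trans b₁ (sym b₂) , trans c₁ (sym c₂) , trans d₁ (sym d₂))
  SimEdgesAre⇒SameC4 y z (inj₁ (a₁ , d₁ , b₁ , c₁)) (inj₂ (b₂ , c₂ , a₂ , d₂)) =
    inj₂ (trans a₁ (sym b₂) , trans b₁ (sym a₂) , trans c₁ (sym d₂) , trans d₁ (sym c₂))
  SimEdgesAre⇒SameC4 y z (inj₂ (b₁ , c₁ , a₁ , d₁)) (inj₁ (a₂ , d₂ , b₂ , c₂)) =
    inj₂ (trans a₁ (sym b₂) , trans b₁ (sym a₂) , trans c₁ (sym d₂) , trans d₁ (sym c₂))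
  SimEdgesAre⇒SameC4 y z (inj₂ (b₁ , c₁ , a₁ , d₁)) (inj₂ (b₂ , c₂ , a₂ , d₂)) =
    inj₁ (trans a₁ (sym a₂) , trans b₁ (sym b₂) , trans c₁ (sym c₂) , trans d₁ (sym d₂))

  disagreement⇒Conflict : ∀ y z {t q q'} → HasS I y t q → HasS I z t q' → q ≢ q' → Conflict I y z
  disagreement⇒Conflict y z {t} {q} {q'} tq tq' q≢q' =
    (λ y≈z → q≢q' (HasS-functional z (SameC4-HasS y z y≈z tq) tq')) ,
    t , q , t , q' , tq , tq' , (λ (_ , q≡q') → q≢q' q≡q') , inj₁ refl

  ¬Conflict⇒agreement : ∀ y z {t q q'} → ¬ Conflict I y z → HasS I y t q → HasS I z t q' → q ≡ q'
  ¬Conflict⇒agreement y z {q = q} {q'} ¬yz tq tq' with q ≟ q'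
  ... | yes q≡q' = q≡q'
  ... | no q≢q' = ⊥-elim (¬yz (disagreement⇒Conflict y z tq tq' q≢q'))

  HasE₁⇒InV₁ : ∀ y {s t} → HasE₁ I y s t → InV₁ I y s
  HasE₁⇒InV₁ _ (inj₁ (s≡a , _)) = inj₁ s≡a
  HasE₁⇒InV₁ _ (inj₂ (s≡b , _)) = inj₂ s≡b

  HasE₂⇒InV₂ : ∀ y {w r} → HasE₂ I y w r → InV₂ I y w
  HasE₂⇒InV₂ _ (inj₁ (w≡c , _)) = inj₁ w≡c
  HasE₂⇒InV₂ _ (inj₂ (w≡d , _)) = inj₂ w≡d

  ShareEdge⇒ShareVertex : ∀ y z → ShareEdge I y z → ShareVertex I y z
  ShareEdge⇒ShareVertex y z (inj₁ (s , _ , ys , zs)) = inj₁ (s , HasE₁⇒InV₁ y ys , HasE₁⇒InV₁ z zs)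
  ShareEdge⇒ShareVertex y z (inj₂ (inj₁ (w , _ , yw , zw))) =
    inj₂ (w , HasE₂⇒InV₂ y yw , HasE₂⇒InV₂ z zw)
  ShareEdge⇒ShareVertex y z (inj₂ (inj₂ (s , _ , ys , zs))) =
    inj₁ (s , HasS⇒InV₁ y ys , HasS⇒InV₁ z zs)

module _ {n1 n2 m1 m2 : ℕ} {I : Instance n1 n2 m1 m2} {n : ℕ} {x : Fin (4 + n) → C4 I}
         (path : InducedPath I (4 + n) x) where
  open InducedPath path

  endpoints-distinct : ¬ SameC4 I (x fzero) (x (fromℕ (3 + n)))
  endpoints-distinct x₁≈xₖ with () ← distinct fzero (fromℕ (3 + n)) x₁≈xₖ

  endpoints-nonadjacent : ¬ Conflict I (x fzero) (x (fromℕ (3 + n)))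
  endpoints-nonadjacent x₁xₖ with induced fzero (fromℕ (3 + n)) x₁xₖ
  ... | inj₁ ()
  ... | inj₂ ()

  endpoints-no-common-neighbour : ∀ j → Conflict I (x fzero) (x j) → ¬ Conflict I (x j) (x (fromℕ (3 + n)))
  endpoints-no-common-neighbour j x₁xⱼ xⱼxₖ
    with induced fzero j x₁xⱼ | induced j (fromℕ (3 + n)) xⱼxₖ
  ... | inj₁ j≡1 | inj₁ k≡j+1 with () ← trans k≡j+1 (cong suc j≡1)
  ... | inj₁ j≡1 | inj₂ j≡k+1 with () ← trans (sym j≡1) j≡k+1

  consecutive-conflict : ∀ (i : Fin (3 + n)) → Conflict I (x (inject₁ i)) (x (fsuc i))
  consecutive-conflict i = adjacent (inject₁ i) (fsuc i) (cong suc (sym (toℕ-inject₁ i)))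

module _ {n1 n2 m1 : ℕ} (I : Instance n1 n2 m1 1) where

  sim-left-unique : ∀ {u u' w} → SimEdge I u w → SimEdge I u' w → u ≡ u'
  sim-left-unique = deg₂≤1⇒left-unique (S I) (deg₂-bound I _)

  Conflict⇒disagreement : ∀ y z → Conflict I y z →
                          ∃ λ t → Σ (Fin n2) λ q → Σ (Fin n2) λ q' →
                            HasS I y t q × HasS I z t q' × q ≢ q'
  Conflict⇒disagreement _ _ (_ , t , q , _ , q' , tq , tq' , ≢ , inj₁ refl) =
    t , q , q' , tq , tq' , λ q≡q' → ≢ (refl , q≡q')
  Conflict⇒disagreement y z (_ , _ , q , _ , _ , tq , tq' , ≢ , inj₂ refl) =
    ⊥-elim (≢ (sim-left-unique (HasS⇒SimEdge y tq) (HasS⇒SimEdge z tq') , refl))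

  ShareVertex⇒shareV₁ : ∀ y z → ShareVertex I y z → ∃ λ u → InV₁ I y u × InV₁ I z u
  ShareVertex⇒shareV₁ _ _ (inj₁ shared) = shared
  ShareVertex⇒shareV₁ y z (inj₂ (w , w∈y , w∈z)) with InV₂⇒HasS y w∈y | InV₂⇒HasS z w∈z
  ... | t , tw | t' , t'w with refl ← sim-left-unique (HasS⇒SimEdge y tw) (HasS⇒SimEdge z t'w)
    = t , HasS⇒InV₁ y tw , HasS⇒InV₁ z t'w

  PinnedAt : Fin n1 → Fin n2 → C4 I → Set
  PinnedAt u w y = ∀ {q} → HasS I y u q → q ≡ w

  WithinComponent : Fin n1 → Fin n1 → C4 I → Set
  WithinComponent u v y = ∀ {s} → InV₁ I y s → s ≡ u ⊎ Star (EdgeAvoiding (G₁ I) u) v s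

  WithinComponent-Conflict : ∀ {u v w} y z → PinnedAt u w y → PinnedAt u w z →
                             WithinComponent u v y → Conflict I y z → WithinComponent u v z
  WithinComponent-Conflict {u} y z pinned-y pinned-z within-y yz {s} s∈z with Conflict⇒disagreement y z yz
  ... | t , q , q' , tq , tq' , q≢q' with t ≟ u
  ...   | yes refl = ⊥-elim (q≢q' (trans (pinned-y tq) (sym (pinned-z tq'))))
  ...   | no t≢u with within-y (HasS⇒InV₁ y tq) | InV₁⇒mate z (HasS⇒InV₁ z tq')
  ...     | inj₁ t≡u | _ = ⊥-elim (t≢u t≡u)
  ...     | inj₂ v⇝t | t' , tt' , _ , cover with cover s∈z
  ...       | inj₁ refl = inj₂ v⇝t
  ...       | inj₂ refl with s ≟ u
  ...         | yes s≡u = inj₁ s≡u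
  ...         | no s≢u = inj₂ (v⇝t ◅◅ ((tt' , s≢u) ◅ ε))

  module Endpoints (acyclic : Acyclic (G₁ I)) {n : ℕ} {x : Fin (4 + n) → C4 I}
                   (path : InducedPath I (4 + n) x) where

    x₁ xₖ : C4 I
    x₁ = x fzero
    xₖ = x (fromℕ (3 + n))

    pinned-by-endpoints : ∀ {u w} → HasS I x₁ u w → HasS I xₖ u w →
                          ∀ j → PinnedAt u w (x j)
    pinned-by-endpoints {w = w} uw₁ uwₖ j {q} uq with q ≟ w
    ... | yes q≡w = q≡w
    ... | no q≢w = ⊥-elim (endpoints-no-common-neighbour path j
                    (disagreement⇒Conflict x₁ (x j) uw₁ uq (λ w≡q → q≢w (sym w≡q)))
                    (disagreement⇒Conflict (x j) xₖ uq uwₖ q≢w))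

    within-component : ∀ {u v w} → (∀ j → PinnedAt u w (x j)) →
                       (∀ {s} → InV₁ I x₁ s → s ≡ u ⊎ s ≡ v) → ∀ j → WithinComponent u v (x j)
    within-component {u} {v} pinned cover₁ =
      <-weakInduction (λ j → WithinComponent u v (x j)) within-x₁
        (λ i within-i → WithinComponent-Conflict (x (inject₁ i)) (x (fsuc i)) (pinned _) (pinned _)
                                                  within-i (consecutive-conflict path i))
      where
      within-x₁ : WithinComponent u v x₁
      within-x₁ s∈x₁ with cover₁ s∈x₁
      ... | inj₁ s≡u = inj₁ s≡u
      ... | inj₂ refl = inj₂ ε

    mates-equal : ∀ {u v v'} → Edge (G₁ I) u v → Edge (G₁ I) u v' →
                  v' ≡ u ⊎ Star (EdgeAvoiding (G₁ I) u) v v' → v' ≡ v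
    mates-equal _ uv' (inj₁ v'≡u) = ⊥-elim (Edge⇒≢ (G₁ I) uv' (sym v'≡u))
    mates-equal uv uv' (inj₂ v⇝v') =
      SimplePaths.acyclic⇒neighbours-disconnected (G₁ I) uv acyclic uv' v⇝v'

    endpoints-share-no-V₁ : ∀ {u} → InV₁ I x₁ u → ¬ InV₁ I xₖ u
    endpoints-share-no-V₁ u∈x₁ u∈xₖ
      with InV₁⇒HasS x₁ u∈x₁ | InV₁⇒mate x₁ u∈x₁
         | InV₁⇒HasS xₖ u∈xₖ | InV₁⇒mate xₖ u∈xₖ
    ... | w , uw₁ | v , uv , v∈x₁ , cover₁ | _ , uwₖ | v' , uv' , v'∈xₖ , _
      with refl ← ¬Conflict⇒agreement x₁ xₖ (endpoints-nonadjacent path) uw₁ uwₖ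
      with refl ← mates-equal uv uv'
                    (within-component (pinned-by-endpoints uw₁ uwₖ) cover₁ (fromℕ (3 + n)) v'∈xₖ)
      with InV₁⇒HasS x₁ v∈x₁ | InV₁⇒HasS xₖ v'∈xₖ
    ... | _ , vp₁ | _ , vpₖ
      with refl ← ¬Conflict⇒agreement x₁ xₖ (endpoints-nonadjacent path) vp₁ vpₖ
      = endpoints-distinct path (SimEdgesAre⇒SameC4 x₁ xₖ
          (HasS-pair⇒SimEdgesAre x₁ uw₁ vp₁ (Edge⇒≢ (G₁ I) uv))
          (HasS-pair⇒SimEdgesAre xₖ uwₖ vpₖ (Edge⇒≢ (G₁ I) uv)))

lemma1 : ∀ {n1 n2 m1 : ℕ} (I : Instance n1 n2 m1 1) → Acyclic (G₁ I) →
         (n : ℕ) (x : Fin (4 + n) → C4 I) → InducedPath I (4 + n) x →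
         ¬ ShareVertex I (x fzero) (x (fromℕ (3 + n)))
         × ¬ ShareEdge I (x fzero) (x (fromℕ (3 + n)))
lemma1 I acyclic n x path =
  no-shared-vertex , λ shared-edge → no-shared-vertex (ShareEdge⇒ShareVertex x₁ xₖ shared-edge)
  where
  open Endpoints I acyclic path

  no-shared-vertex : ¬ ShareVertex I x₁ xₖ
  no-shared-vertex shared with ShareVertex⇒shareV₁ I x₁ xₖ shared
  ... | _ , u∈x₁ , u∈xₖ = endpoints-share-no-V₁ u∈x₁ u∈xₖ
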